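{- Let $G$ be a connected graph of order $n\geq 5$, size $m$ (number of edges), minimum degree $\delta\geq 2$ and vertex-connectivity $\kappa$. (a) If $m \geq \binom{n-2}{2}+2\delta-1$, then $\kappa=\delta$, unless $G\cong K_{\delta-1}\vee (K_2\cup K_{n-\delta-1})$. (b) If $n\geq 2\delta+3$ and $m \geq \binom{n-2}{2}+\delta$, then $\kappa=\delta$, unless $G$ is isomorphic to a subgraph of $K_{\delta-1}\vee (K_2\cup K_{n-\delta-1})$.
   Context: All graphs are finite, simple and undirected. The vertex-connectivity $\kappa(G)$ of a connected non-complete graph is the minimum size of a vertex set whose removal disconnects $G$, and $\kappa(K_n)=n-1$. $K_r$ is the complete graph on $r$ vertices, $\cup$ is disjoint union and $G_1\vee G_2$ is the join (disjoint union plus all edges between $G_1$ and $G_2$). -}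

module Defs where

open import Data.Nat using (ℕ; zero; suc; _+_; _∸_; _≤_; _<ᵇ_; _≡ᵇ_)
open import Data.Bool using (Bool; true; false; _∧_; _∨_; not; if_then_else_)
open import Data.Fin using (Fin; toℕ)
open import Data.Fin.Subset using (Subset; _∈_; _∉_; ∣_∣)
open import Data.List using (List; map; allFin)
open import Data.Nat.ListAction using (sum)
open import Data.Product using (Σ; _×_; ∃)
open import Data.Empty using (⊥)
open import Relation.Nullary using (¬_)
open import Relation.Binary.PropositionalEquality using (_≡_; _≢_)
open import Function.Bundles using (Inverse; _↔_)
open import Function.Base using (_∘_)

record Graph (n : ℕ) : Set where
  field
    adj   : Fin n → Fin n → Bool
    sym   : ∀ u v → adj u v ≡ adj v u
    irrefl : ∀ v → adj v v ≡ false
open Graph public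

countB : ∀ {n} → (Fin n → Bool) → ℕ
countB {n} f = sum (map (λ i → if f i then 1 else 0) (allFin n))

degree : ∀ {n} → Graph n → Fin n → ℕ
degree G v = countB (adj G v)

size : ∀ {n} → Graph n → ℕ
size {n} G = sum (map (λ i → countB (λ j → (toℕ i <ᵇ toℕ j) ∧ adj G i j)) (allFin n))

IsMinDegree : ∀ {n} → Graph n → ℕ → Set
IsMinDegree G d = (∀ v → d ≤ degree G v) × (∃ λ v → degree G v ≡ d)

data PathAvoiding {n} (G : Graph n) (S : Subset n) : Fin n → Fin n → Set where
  here : ∀ {u} → u ∉ S → PathAvoiding G S u u
  step : ∀ {u w v} → u ∉ S → adj G u w ≡ true → PathAvoiding G S w v → PathAvoiding G S u v

∅ : ∀ {n} → Subset n
∅ {zero} = Data.Vec.[] where import Data.Vec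
∅ {suc n} = Data.Vec._∷_ false ∅ where import Data.Vec

Connected : ∀ {n} → Graph n → Set
Connected G = ∀ u v → PathAvoiding G ∅ u v

Complete : ∀ {n} → Graph n → Set
Complete G = ∀ u v → u ≢ v → adj G u v ≡ true

Separates : ∀ {n} → Graph n → Subset n → Set
Separates G S = Σ _ λ u → Σ _ λ v → u ∉ S × v ∉ S × ¬ PathAvoiding G S u v

IsConnectivity : ∀ {n} → Graph n → ℕ → Set
IsConnectivity {n} G k =
  (Complete G → k ≡ n ∸ 1) ×
  (¬ Complete G → (Σ (Subset n) λ S → Separates G S × ∣ S ∣ ≡ k)
                × (∀ S → Separates G S → k ≤ ∣ S ∣))

-- Adjacency of K_{d-1} ∨ (K_2 ∪ K_{n-d-1}) on Fin n:
-- vertices 0..d-2 form K_{d-1} (block 0), d-1 and d form K_2 (block 1),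
-- vertices d+1..n-1 form K_{n-d-1} (block 2).
block : ℕ → ℕ → ℕ
block d x = if x <ᵇ (d ∸ 1) then 0 else (if x <ᵇ (d + 1) then 1 else 2)

specialAdj : (n d : ℕ) → Fin n → Fin n → Bool
specialAdj n d u v =
  not (toℕ u ≡ᵇ toℕ v) ∧
  ((block d (toℕ u) ≡ᵇ 0) ∨ (block d (toℕ v) ≡ᵇ 0) ∨ (block d (toℕ u) ≡ᵇ block d (toℕ v)))

IsoSpecial : ∀ {n} → Graph n → ℕ → Set
IsoSpecial {n} G d = Σ (Fin n ↔ Fin n) λ f →
  ∀ u v → adj G u v ≡ specialAdj n d (Inverse.to f u) (Inverse.to f v)

SubgraphSpecial : ∀ {n} → Graph n → ℕ → Set
SubgraphSpecial {n} G d = Σ (Fin n → Fin n) λ f →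
  (∀ u v → f u ≡ f v → u ≡ v) ×
  (∀ u v → adj G u v ≡ true → specialAdj n d (f u) (f v) ≡ true)

-- If n ≤ δ + 1 the graph is complete and κ = δ = n − 1. Otherwise the neighbourhood of a
-- vertex of minimum degree separates, so κ ≤ δ. If κ < δ, take a minimum separator S of size
-- s and split G − S into a side A (a component) and the rest B; no edge joins A and B.
-- A vertex of A has at most s + |A| − 1 neighbours, so |A|, |B| ≥ δ + 1 − s, while
-- m ≤ C(n,2) − |A||B|. Writing δ = s + 1 + u, |A| = u + 2 + a′, |B| = u + 2 + b′, the edge bound
-- of (a) forces u = 0, a′ = 0 or b′ = 0, and m = C(n,2) − |A||B|: G consists of all pairs not
-- joining A to B, with |S| = δ − 1 and a side of size 2, i.e. K_{δ−1} ∨ (K₂ ∪ K_{n−δ−1}).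
-- Under (b) the same count leaves either a side of size 2, or G has all those pairs and a vertex
-- of degree δ = s + 1 again pins a side of size 2. Sorting the vertices as S, the small side,
-- the rest then maps G into the special graph.

module Submission where

open import Defs renaming (sym to adj-sym)
open import Data.Bool using (Bool; true; false; _∧_; _∨_; not; if_then_else_)
import Data.Bool as Bool using (_≟_)
open import Data.Bool.Properties using (∧-zeroʳ; ∧-identityʳ; ∨-zeroʳ; ∨-identityʳ; T-≡; ∨-conicalˡ; ∨-conicalʳ; ∧-conicalˡ; ∧-conicalʳ; not-injective)
open import Function.Bundles using (Equivalence; _↔_; mk↔ₛ′)
open import Data.Fin using (Fin; zero; suc; toℕ; fromℕ<; punchOut)
import Data.Fin as Fin using (_≟_)
open import Data.Fin.Properties using (toℕ-injective; toℕ<n; toℕ-fromℕ<; any?; punchOut-injective; injective⇒≤)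
open import Data.Fin.Subset using (Subset; _∉_; ∣_∣)
open import Data.Vec as Vec using ([]; _∷_)
open import Data.Vec.Properties using ([]=⇒lookup; lookup⇒[]=; lookup∘tabulate)
import Data.List as List using (map; tabulate)
import Data.Nat.ListAction as List using (sum)
open import Data.Nat using (ℕ; zero; suc; _+_; _*_; _∸_; _≤_; _<_; _<ᵇ_; _≡ᵇ_; z≤n; s≤s; _≤?_)
open import Data.Nat.Properties
open import Algebra.Properties.Semiring.Sum +-*-semiring
  using (sum; sum-cong-≗; ∑-distrib-+; ∑-comm; *-distribˡ-sum; *-distribʳ-sum)
open import Data.Nat.Combinatorics using (_C_; nC1≡n; nCk+nC[k+1]≡[n+1]C[k+1])
open import Data.Product using (Σ-syntax; ∃-syntax; _×_; _,_; proj₁; proj₂)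
open import Data.Sum using (_⊎_; inj₁; inj₂)
open import Function.Base using (_∘_)
open import Relation.Binary using (tri<; tri≈; tri>)
open import Relation.Nullary using (¬_; yes; no; does; contradiction)
open import Relation.Binary.PropositionalEquality
open import Data.Nat.Tactic.RingSolver using (solve-∀)

private variable
  m n : ℕ

fromBool : Bool → ℕ
fromBool b = if b then 1 else 0

count : (Fin n → Bool) → ℕ
count P = sum (fromBool ∘ P)

count² : (Fin m → Fin n → Bool) → ℕ
count² R = sum (count ∘ R)

_⊆ᵇ_ : (Fin n → Bool) → (Fin n → Bool) → Set
P ⊆ᵇ Q = ∀ i → P i ≡ true → Q i ≡ true

Disjoint : (Fin n → Bool) → (Fin n → Bool) → Set
Disjoint P Q = ∀ i → P i ∧ Q i ≡ false

sum-mono-≤ : {f g : Fin n → ℕ} → (∀ i → f i ≤ g i) → sum f ≤ sum g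
sum-mono-≤ {zero}  f≤g = z≤n
sum-mono-≤ {suc n} f≤g = +-mono-≤ (f≤g zero) (sum-mono-≤ (f≤g ∘ suc))

sum-mono-< : {f g : Fin n → ℕ} → (∀ i → f i ≤ g i) → ∀ k → f k < g k → sum f < sum g
sum-mono-< f≤g zero    fk<gk = +-mono-<-≤ fk<gk (sum-mono-≤ (f≤g ∘ suc))
sum-mono-< f≤g (suc k) fk<gk = +-mono-≤-< (f≤g zero) (sum-mono-< (f≤g ∘ suc) k fk<gk)

fromBool-mono : ∀ {a b} → (a ≡ true → b ≡ true) → fromBool a ≤ fromBool b
fromBool-mono {false} _   = z≤n
fromBool-mono {true}  a⇒b rewrite a⇒b refl = ≤-refl

fromBool-∨ : ∀ a b → a ∧ b ≡ false → fromBool (a ∨ b) ≡ fromBool a + fromBool b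
fromBool-∨ false b _ = refl
fromBool-∨ true false _ = refl

fromBool-∧ : ∀ a b → fromBool (a ∧ b) ≡ fromBool a * fromBool b
fromBool-∧ false b = refl
fromBool-∧ true  b = sym (+-identityʳ (fromBool b))

count-cong : {P Q : Fin n → Bool} → (∀ i → P i ≡ Q i) → count P ≡ count Q
count-cong P≗Q = sum-cong-≗ (cong fromBool ∘ P≗Q)

count-mono : {P Q : Fin n → Bool} → P ⊆ᵇ Q → count P ≤ count Q
count-mono P⊆Q = sum-mono-≤ (fromBool-mono ∘ P⊆Q)

count-mono-< : {P Q : Fin n → Bool} → P ⊆ᵇ Q → ∀ k → P k ≡ false → Q k ≡ true → count P < count Q
count-mono-< P⊆Q k Pk Qk =
  sum-mono-< (fromBool-mono ∘ P⊆Q) k (subst₂ (λ a b → fromBool a < fromBool b) (sym Pk) (sym Qk) ≤-refl)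

count-⊤ : ∀ n → count {n} (λ _ → true) ≡ n
count-⊤ zero    = refl
count-⊤ (suc n) = cong suc (count-⊤ n)

count-⊥ : ∀ n → count {n} (λ _ → false) ≡ 0
count-⊥ zero    = refl
count-⊥ (suc n) = count-⊥ n

count-≤ : (P : Fin n → Bool) → count P ≤ n
count-≤ {n} P = ≤-trans (count-mono {n} {P} {λ _ → true} (λ _ _ → refl)) (≤-reflexive (count-⊤ n))

count-∨ : (P Q : Fin n → Bool) → Disjoint P Q → count (λ i → P i ∨ Q i) ≡ count P + count Q
count-∨ P Q P∩Q = trans (sum-cong-≗ (λ i → fromBool-∨ (P i) (Q i) (P∩Q i)))
                         (∑-distrib-+ (fromBool ∘ P) (fromBool ∘ Q))

⊆∧count≥⇒⊇ : {P Q : Fin n → Bool} → P ⊆ᵇ Q → count Q ≤ count P → Q ⊆ᵇ P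
⊆∧count≥⇒⊇ {P = P} P⊆Q Q≤P i Qi with P i in Pi
... | true  = refl
... | false = contradiction Q≤P (<⇒≱ (count-mono-< P⊆Q i Pi Qi))

count<⇒∃false : (P : Fin n → Bool) → count P < n → ∃[ i ] P i ≡ false
count<⇒∃false {suc n} P P<n with P zero in P0
... | false = zero , P0
... | true  with count<⇒∃false (P ∘ suc) (≤-pred P<n)
...   | i , Pi = suc i , Pi

count²-mono : {R R′ : Fin m → Fin n → Bool} → (∀ i → R i ⊆ᵇ R′ i) → count² R ≤ count² R′
count²-mono R⊆R′ = sum-mono-≤ (count-mono ∘ R⊆R′)

count²-mono-< : {R R′ : Fin m → Fin n → Bool} → (∀ i → R i ⊆ᵇ R′ i) →
                ∀ p q → R p q ≡ false → R′ p q ≡ true → count² R < count² R′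
count²-mono-< R⊆R′ p q Rpq R′pq = sum-mono-< (count-mono ∘ R⊆R′) p (count-mono-< (R⊆R′ p) q Rpq R′pq)

count²-∨ : (R R′ : Fin m → Fin n → Bool) → (∀ i → Disjoint (R i) (R′ i)) →
           count² (λ i j → R i j ∨ R′ i j) ≡ count² R + count² R′
count²-∨ {m = m} R R′ R∩R′ = trans (sum-cong-≗ {m} (λ i → count-∨ (R i) (R′ i) (R∩R′ i)))
                                    (∑-distrib-+ (count ∘ R) (count ∘ R′))

count²-cong : {R R′ : Fin m → Fin n → Bool} → (∀ i j → R i j ≡ R′ i j) → count² R ≡ count² R′
count²-cong R≗R′ = sum-cong-≗ (λ i → count-cong (R≗R′ i))

count²-transpose : (R : Fin m → Fin n → Bool) → count² R ≡ count² (λ j i → R i j)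
count²-transpose R = ∑-comm (λ i j → fromBool (R i j))

count²-∧ : (P : Fin m → Bool) (Q : Fin n → Bool) → count² (λ i j → P i ∧ Q j) ≡ count P * count Q
count²-∧ {m = m} {n = n} P Q = begin
  sum {m} (λ i → sum {n} (λ j → fromBool (P i ∧ Q j)))
    ≡⟨ sum-cong-≗ {m} (λ i → sum-cong-≗ {n} (λ j → fromBool-∧ (P i) (Q j))) ⟩
  sum {m} (λ i → sum {n} (λ j → fromBool (P i) * fromBool (Q j)))
    ≡⟨ sum-cong-≗ {m} (λ i → sym (*-distribˡ-sum (fromBool (P i)) (fromBool ∘ Q))) ⟩
  sum {m} (λ i → fromBool (P i) * count Q)
    ≡⟨ sym (*-distribʳ-sum (count Q) (fromBool ∘ P)) ⟩
  count P * count Q ∎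
  where open ≡-Reasoning

sum-map-tabulate : ∀ {A : Set} (h : A → ℕ) (g : Fin n → A) →
                   List.sum (List.map h (List.tabulate g)) ≡ sum (h ∘ g)
sum-map-tabulate {zero}  h g = refl
sum-map-tabulate {suc n} h g = cong (h (g zero) +_) (sum-map-tabulate h (g ∘ suc))

countB≡count : (P : Fin n → Bool) → countB P ≡ count P
countB≡count P = sum-map-tabulate (fromBool ∘ P) (λ i → i)

-- Equality and order on Fin n, decided on toℕ as in specialAdj

_==_ : Fin n → Fin n → Bool
i == j = toℕ i ≡ᵇ toℕ j

_<ᶠ_ : Fin n → Fin n → Bool
i <ᶠ j = toℕ i <ᵇ toℕ j

≡ᵇ-refl : ∀ x → (x ≡ᵇ x) ≡ true
≡ᵇ-refl zero    = refl
≡ᵇ-refl (suc x) = ≡ᵇ-refl x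

≡ᵇ-sym : ∀ x y → (x ≡ᵇ y) ≡ (y ≡ᵇ x)
≡ᵇ-sym zero    zero    = refl
≡ᵇ-sym zero    (suc y) = refl
≡ᵇ-sym (suc x) zero    = refl
≡ᵇ-sym (suc x) (suc y) = ≡ᵇ-sym x y

≡ᵇ⇒≡′ : ∀ x y → (x ≡ᵇ y) ≡ true → x ≡ y
≡ᵇ⇒≡′ x y e = ≡ᵇ⇒≡ x y (Equivalence.from T-≡ e)

==-refl : (i : Fin n) → i == i ≡ true
==-refl i = ≡ᵇ-refl (toℕ i)

==-sym : (i j : Fin n) → i == j ≡ j == i
==-sym i j = ≡ᵇ-sym (toℕ i) (toℕ j)

==⇒≡ : (i j : Fin n) → i == j ≡ true → i ≡ j
==⇒≡ i j e = toℕ-injective (≡ᵇ⇒≡′ (toℕ i) (toℕ j) e)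

==-≢ : {i j : Fin n} → i ≢ j → i == j ≡ false
==-≢ {i = i} {j} i≢j with i == j in e
... | false = refl
... | true  = contradiction (==⇒≡ i j e) i≢j

count-== : (v : Fin n) → count (_== v) ≡ 1
count-== {suc n} zero    = cong suc (count-⊥ n)
count-== {suc n} (suc v) = count-== v

<ᵇ-irrefl : ∀ x → (x <ᵇ x) ≡ false
<ᵇ-irrefl zero    = refl
<ᵇ-irrefl (suc x) = <ᵇ-irrefl x

<ᵇ-asym : ∀ x y → (x <ᵇ y) ∧ (y <ᵇ x) ≡ false
<ᵇ-asym zero    zero    = refl
<ᵇ-asym zero    (suc y) = refl
<ᵇ-asym (suc x) zero    = refl
<ᵇ-asym (suc x) (suc y) = <ᵇ-asym x y

<ᵇ-connex : ∀ x y → (x <ᵇ y) ≡ false → (y <ᵇ x) ≡ false → x ≡ y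
<ᵇ-connex zero    zero    _ _ = refl
<ᵇ-connex (suc x) (suc y) p q = cong suc (<ᵇ-connex x y p q)

-- Row 0 contributes n, and column 0 contributes nothing to the other rows.
count²-<ᶠ : ∀ n → count² {n} _<ᶠ_ ≡ n C 2
count²-<ᶠ zero    = refl
count²-<ᶠ (suc n) = begin
  count {n} (λ _ → true) + count² {n} _<ᶠ_ ≡⟨ cong₂ _+_ (count-⊤ n) (count²-<ᶠ n) ⟩
  n + n C 2                                ≡⟨ cong (_+ n C 2) (sym (nC1≡n n)) ⟩
  n C 1 + n C 2                            ≡⟨ nCk+nC[k+1]≡[n+1]C[k+1] n 1 ⟩
  suc n C 2                                ∎
  where open ≡-Reasoning

-- Each unordered pair {i, j} of a symmetric irreflexive relation is counted once as i < j and once as j < i.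
count²-symmetric : (R : Fin n → Fin n → Bool) → (∀ i j → R i j ≡ R j i) → (∀ i → R i i ≡ false) →
                   count² R ≡ 2 * count² (λ i j → (i <ᶠ j) ∧ R i j)
count²-symmetric R R-sym R-irrefl = begin
  count² R                               ≡⟨ count²-cong R≡below∨above ⟩
  count² (λ i j → below i j ∨ above i j) ≡⟨ count²-∨ below above below∩above ⟩
  count² below + count² above            ≡⟨ cong (count² below +_) (count²-transpose above) ⟩
  count² below + count² (λ j i → above i j)
    ≡⟨ cong (count² below +_) (count²-cong (λ j i → cong ((j <ᶠ i) ∧_) (R-sym i j))) ⟩
  count² below + count² below            ≡⟨ cong (count² below +_) (sym (+-identityʳ (count² below))) ⟩
  2 * count² below                       ∎
  where
  open ≡-Reasoning
  below above : Fin _ → Fin _ → Bool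
  below i j = (i <ᶠ j) ∧ R i j
  above i j = (j <ᶠ i) ∧ R i j
  below∩above : ∀ i j → below i j ∧ above i j ≡ false
  below∩above i j with i <ᶠ j in i<j | j <ᶠ i in j<i
  ... | true  | true  = contradiction (trans (sym (cong₂ _∧_ i<j j<i)) (<ᵇ-asym (toℕ i) (toℕ j))) λ ()
  ... | true  | false = ∧-zeroʳ (R i j)
  ... | false | _     = refl
  R≡below∨above : ∀ i j → R i j ≡ below i j ∨ above i j
  R≡below∨above i j with R i j in Rij | i <ᶠ j in i<j | j <ᶠ i in j<i
  ... | false | i<j?  | j<i?  = sym (cong₂ _∨_ (∧-zeroʳ i<j?) (∧-zeroʳ j<i?))
  ... | true  | true  | _     = refl
  ... | true  | false | true  = refl
  ... | true  | false | false =
    trans (sym Rij) (trans (cong (R i) (sym (toℕ-injective (<ᵇ-connex _ _ i<j j<i)))) (R-irrefl i))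

count²-≢ : ∀ n → count² {n} {n} (λ i j → not (i == j)) ≡ 2 * (n C 2)
count²-≢ n = trans (count²-symmetric {n} (λ i j → not (i == j)) (λ i j → cong not (==-sym i j))
                                                                (λ i → cong not (==-refl i)))
                   (cong (2 *_) (trans (count²-cong below≡<ᶠ) (count²-<ᶠ n)))
  where
  below≡<ᶠ : ∀ (i j : Fin n) → (i <ᶠ j) ∧ not (i == j) ≡ i <ᶠ j
  below≡<ᶠ i j with i == j in i=j
  ... | false = ∧-identityʳ _
  ... | true  rewrite ==⇒≡ i j i=j = trans (∧-zeroʳ _) (sym (<ᵇ-irrefl (toℕ j)))

degree≡count : (G : Graph n) (v : Fin n) → degree G v ≡ count (adj G v)
degree≡count G v = countB≡count (adj G v)

adj⇒≢ : (G : Graph n) {v w : Fin n} → adj G v w ≡ true → w == v ≡ false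
adj⇒≢ G {v} {w} vw with w == v in e
... | false = refl
... | true  rewrite ==⇒≡ w v e = contradiction (trans (sym vw) (irrefl G v)) λ ()

closedNbhd : Graph n → Fin n → Fin n → Bool
closedNbhd G v w = adj G v w ∨ (w == v)

count-closedNbhd : (G : Graph n) (v : Fin n) → count (closedNbhd G v) ≡ suc (degree G v)
count-closedNbhd G v = begin
  count (closedNbhd G v)           ≡⟨ count-∨ (adj G v) (_== v) adj∩self ⟩
  count (adj G v) + count (_== v)  ≡⟨ cong₂ _+_ (sym (degree≡count G v)) (count-== v) ⟩
  degree G v + 1                   ≡⟨ +-comm (degree G v) 1 ⟩
  suc (degree G v)                 ∎
  where
  open ≡-Reasoning
  adj∩self : Disjoint (adj G v) (_== v)
  adj∩self w with adj G v w in vw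
  ... | false = refl
  ... | true  = adj⇒≢ G vw

degree<n : (G : Graph n) (v : Fin n) → suc (degree G v) ≤ n
degree<n G v = subst (_≤ _) (count-closedNbhd G v) (count-≤ (closedNbhd G v))

closedNbhd-full : (G : Graph n) (v : Fin n) → n ≤ suc (degree G v) → ∀ w → closedNbhd G v w ≡ true
closedNbhd-full {n} G v n≤ w = ⊆∧count≥⇒⊇ {P = closedNbhd G v} {Q = λ _ → true} (λ _ _ → refl)
  (subst₂ _≤_ (sym (count-⊤ n)) (sym (count-closedNbhd G v)) n≤) w refl

nonNeighbour : (G : Graph n) (v : Fin n) → suc (degree G v) < n → ∃[ w ] closedNbhd G v w ≡ false
nonNeighbour G v 1+deg<n = count<⇒∃false (closedNbhd G v) (subst (_< _) (sym (count-closedNbhd G v)) 1+deg<n)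

complete-if-degrees : (G : Graph n) → (∀ v → n ≤ suc (degree G v)) → Complete G
complete-if-degrees G big u v u≢v = trans (sym (∨-identityʳ (adj G u v)))
  (trans (cong (adj G u v ∨_) (sym (==-≢ (u≢v ∘ sym)))) (closedNbhd-full G u (big u) v))

lookup≡false⇒∉ : (S : Subset n) {i : Fin n} → Vec.lookup S i ≡ false → i ∉ S
lookup≡false⇒∉ S Si≡false i∈S = contradiction (trans (sym ([]=⇒lookup i∈S)) Si≡false) λ ()

∉⇒lookup≡false : (S : Subset n) {i : Fin n} → i ∉ S → Vec.lookup S i ≡ false
∉⇒lookup≡false S {i} i∉S with Vec.lookup S i in Si
... | false = refl
... | true  = contradiction (lookup⇒[]= i S Si) i∉S

∣S∣≡count : (S : Subset n) → ∣ S ∣ ≡ count (Vec.lookup S)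
∣S∣≡count []            = refl
∣S∣≡count (true  ∷ S) = cong suc (∣S∣≡count S)
∣S∣≡count (false ∷ S) = ∣S∣≡count S

path-head∉ : {G : Graph n} {S : Subset n} {a b : Fin n} → PathAvoiding G S a b → a ∉ S
path-head∉ (here a∉S)     = a∉S
path-head∉ (step a∉S _ _) = a∉S

neighbourhood : Graph n → Fin n → Subset n
neighbourhood G v = Vec.tabulate (adj G v)

∣neighbourhood∣ : (G : Graph n) (v : Fin n) → ∣ neighbourhood G v ∣ ≡ degree G v
∣neighbourhood∣ G v = begin
  ∣ neighbourhood G v ∣                      ≡⟨ ∣S∣≡count (neighbourhood G v) ⟩
  count (Vec.lookup (neighbourhood G v))    ≡⟨ count-cong (lookup∘tabulate (adj G v)) ⟩
  count (adj G v)                           ≡⟨ degree≡count G v ⟨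
  degree G v                                ∎
  where open ≡-Reasoning

neighbourhood-separates : (G : Graph n) (v w : Fin n) → closedNbhd G v w ≡ false →
                          Separates G (neighbourhood G v)
neighbourhood-separates G v w vw∉ = v , w , v∉N , w∉N , no-path
  where
  N = neighbourhood G v
  v∉N : v ∉ N
  v∉N = lookup≡false⇒∉ N (trans (lookup∘tabulate (adj G v) v) (irrefl G v))
  w∉N : w ∉ N
  w∉N = lookup≡false⇒∉ N (trans (lookup∘tabulate (adj G v) w) (∨-conicalˡ (adj G v w) (w == v) vw∉))
  no-path : ¬ PathAvoiding G N v w
  no-path (here _)          = contradiction (trans (sym (==-refl v)) (∨-conicalʳ (adj G v w) (w == v) vw∉)) λ ()
  no-path (step _ vx x→w) = path-head∉ x→w (lookup⇒[]= _ N (trans (lookup∘tabulate (adj G v) _) vx))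

-- Components of G − S

path-snoc : {G : Graph n} {S : Subset n} {a z w : Fin n} →
            PathAvoiding G S a z → adj G z w ≡ true → w ∉ S → PathAvoiding G S a w
path-snoc (here a∉S)          zw w∉S = step a∉S zw (here w∉S)
path-snoc (step a∉S ax x→z) zw w∉S = step a∉S ax (path-snoc x→z zw w∉S)

anyᵇ : (Fin n → Bool) → Bool
anyᵇ P = does (any? (λ i → P i Bool.≟ true))

anyᵇ-intro : (P : Fin n → Bool) {i : Fin n} → P i ≡ true → anyᵇ P ≡ true
anyᵇ-intro P {i} Pi with any? (λ i → P i Bool.≟ true)
... | yes _  = refl
... | no ¬∃P = contradiction (i , Pi) ¬∃P

anyᵇ-elim : (P : Fin n → Bool) → anyᵇ P ≡ true → ∃[ i ] P i ≡ true
anyᵇ-elim P any≡true with any? (λ i → P i Bool.≟ true)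
... | yes ∃P = ∃P

chain-stabilises : (F : ℕ → Fin n → Bool) → (∀ k → F k ⊆ᵇ F (suc k)) → ∃[ k ] F (suc k) ⊆ᵇ F k
chain-stabilises {n} F F↑ with grows-or-stabilises (suc n)
  where
  grows-or-stabilises : ∀ k → (∃[ j ] F (suc j) ⊆ᵇ F j) ⊎ k ≤ count (F k)
  grows-or-stabilises zero = inj₂ z≤n
  grows-or-stabilises (suc k) with grows-or-stabilises k
  ... | inj₁ stable = inj₁ stable
  ... | inj₂ k≤∣Fk∣ with count (F (suc k)) ≤? count (F k)
  ...   | yes no-growth = inj₁ (k , ⊆∧count≥⇒⊇ (F↑ k) no-growth)
  ...   | no  growth    = inj₂ (≤-trans (s≤s k≤∣Fk∣) (≰⇒> growth))
... | inj₁ stable    = stable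
... | inj₂ n<∣Fn+1∣ = contradiction (count-≤ (F (suc n))) (<⇒≱ n<∣Fn+1∣)

module Component (G : Graph n) (S : Subset n) (u : Fin n) where

  reach : ℕ → Fin n → Bool
  reach zero    w = w == u
  reach (suc k) w = reach k w ∨ (not (Vec.lookup S w) ∧ anyᵇ (λ z → reach k z ∧ adj G z w))

  reach-mono : ∀ k → reach k ⊆ᵇ reach (suc k)
  reach-mono k w e = cong (_∨ (not (Vec.lookup S w) ∧ anyᵇ (λ z → reach k z ∧ adj G z w))) e

  reach-sound : u ∉ S → ∀ k {w} → reach k w ≡ true → PathAvoiding G S u w
  reach-sound u∉S zero    {w} e rewrite ==⇒≡ w u e = here u∉S
  reach-sound u∉S (suc k) {w} e with reach k w in r
  ... | true  = reach-sound u∉S k r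
  ... | false with anyᵇ-elim (λ z → reach k z ∧ adj G z w) (∧-conicalʳ (not (Vec.lookup S w)) _ e)
  ...   | z , zw = path-snoc (reach-sound u∉S k (∧-conicalˡ (reach k z) (adj G z w) zw))
                             (∧-conicalʳ (reach k z) (adj G z w) zw)
                             (lookup≡false⇒∉ S (not-injective (∧-conicalˡ (not (Vec.lookup S w)) _ e)))

  stage : ℕ
  stage = proj₁ (chain-stabilises reach reach-mono)

  component : Fin n → Bool
  component = reach stage

  component-u : component u ≡ true
  component-u = go stage
    where
    go : ∀ k → reach k u ≡ true
    go zero    = ==-refl u
    go (suc k) = reach-mono k u (go k)

  component-closed : ∀ {z w} → component z ≡ true → adj G z w ≡ true → Vec.lookup S w ≡ false →
                     component w ≡ true
  component-closed {z} {w} cz zw Sw = proj₂ (chain-stabilises reach reach-mono) w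
    (trans (cong (λ b → component w ∨ (not b ∧ anyᵇ (λ z → component z ∧ adj G z w))) Sw)
           (trans (cong (λ b → component w ∨ b) (anyᵇ-intro (λ z → component z ∧ adj G z w) (cong₂ _∧_ cz zw)))
                  (∨-zeroʳ (component w))))

data Side : Set where
  sep left right : Side

_==ˢ_ : Side → Side → Bool
sep   ==ˢ sep   = true
left  ==ˢ left  = true
right ==ˢ right = true
_     ==ˢ _     = false

across : Side → Side → Bool
across left  right = true
across right left  = true
across _     _     = false

across-irrefl : ∀ x → across x x ≡ false
across-irrefl sep   = refl
across-irrefl left  = refl
across-irrefl right = refl

across-sym : ∀ x y → across x y ≡ across y x
across-sym sep   sep   = refl
across-sym sep   left  = refl
across-sym sep   right = refl
across-sym left  sep   = refl
across-sym left  left  = refl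
across-sym left  right = refl
across-sym right sep   = refl
across-sym right left  = refl
across-sym right right = refl

record Separation (G : Graph n) : Set where
  field
    side         : Fin n → Side
    inner outer  : Fin n
    side-inner   : side inner ≡ left
    side-outer   : side outer ≡ right
    across⇒¬adj : ∀ p q → across (side p) (side q) ≡ true → adj G p q ≡ false

  class : Side → ℕ
  class c = count (λ w → side w ==ˢ c)

separation : (G : Graph n) (S : Subset n) → Separates G S →
             Σ[ σ ∈ Separation G ] Separation.class σ sep ≡ ∣ S ∣
separation {n} G S (u , v , u∉S , v∉S , no-path) = σ , trans (count-cong sep≡S) (sym (∣S∣≡count S))
  where
  open Component G S u
  side : Fin n → Side
  side w = if Vec.lookup S w then sep else if component w then left else right

  sep≡S : ∀ w → side w ==ˢ sep ≡ Vec.lookup S w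
  sep≡S w with Vec.lookup S w | component w
  ... | true  | _     = refl
  ... | false | true  = refl
  ... | false | false = refl

  side≡left⇒ : ∀ {w} → side w ≡ left → Vec.lookup S w ≡ false × component w ≡ true
  side≡left⇒ {w} e with Vec.lookup S w | component w | e
  ... | false | true | _ = refl , refl

  side≡right⇒ : ∀ {w} → side w ≡ right → Vec.lookup S w ≡ false × component w ≡ false
  side≡right⇒ {w} e with Vec.lookup S w | component w | e
  ... | false | false | _ = refl , refl

  left-side≡right⇒¬adj : ∀ {p q} → side p ≡ left → side q ≡ right → adj G p q ≡ false
  left-side≡right⇒¬adj {p} {q} sp sq with adj G p q in pq
  ... | false = refl
  ... | true  = contradiction (trans (sym (component-closed (proj₂ (side≡left⇒ sp)) pq (proj₁ (side≡right⇒ sq))))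
                                     (proj₂ (side≡right⇒ sq))) λ ()

  across⇒¬adj : ∀ p q → across (side p) (side q) ≡ true → adj G p q ≡ false
  across⇒¬adj p q e with side p in sp | side q in sq | e
  ... | left  | right | _ = left-side≡right⇒¬adj sp sq
  ... | right | left  | _ = trans (adj-sym G p q) (left-side≡right⇒¬adj sq sp)

  side-u : side u ≡ left
  side-u rewrite ∉⇒lookup≡false S u∉S | component-u = refl

  side-v : side v ≡ right
  side-v with Vec.lookup S v in Sv | component v in cv
  ... | true  | _     = contradiction (lookup⇒[]= v S Sv) v∉S
  ... | false | true  = contradiction (reach-sound u∉S stage cv) no-path
  ... | false | false = refl

  σ : Separation G
  σ = record
    { side = side ; inner = u ; outer = v
    ; side-inner = side-u ; side-outer = side-v ; across⇒¬adj = across⇒¬adj }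

size≡count² : (G : Graph n) → size G ≡ count² (λ i j → (i <ᶠ j) ∧ adj G i j)
size≡count² {n} G = trans (sum-map-tabulate (λ i → countB (λ j → (i <ᶠ j) ∧ adj G i j)) (λ i → i))
                          (sum-cong-≗ {n} (λ i → countB≡count (λ j → (i <ᶠ j) ∧ adj G i j)))

module _ {G : Graph n} (σ : Separation G) where
  open Separation σ

  compatibleCount : Side → ℕ
  compatibleCount sep   = n
  compatibleCount left  = class sep + class left
  compatibleCount right = class sep + class right

  count-compatible : ∀ x → count (λ w → not (across x (side w))) ≡ compatibleCount x
  count-compatible sep   = count-⊤ n
  count-compatible left  = trans (count-cong (λ w → split (side w))) (count-∨ _ _ (λ w → disjoint (side w)))
    where
    split : ∀ y → not (across left y) ≡ (y ==ˢ sep) ∨ (y ==ˢ left)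
    split sep = refl ; split left = refl ; split right = refl
    disjoint : ∀ y → (y ==ˢ sep) ∧ (y ==ˢ left) ≡ false
    disjoint sep = refl ; disjoint left = refl ; disjoint right = refl
  count-compatible right = trans (count-cong (λ w → split (side w))) (count-∨ _ _ (λ w → disjoint (side w)))
    where
    split : ∀ y → not (across right y) ≡ (y ==ˢ sep) ∨ (y ==ˢ right)
    split sep = refl ; split left = refl ; split right = refl
    disjoint : ∀ y → (y ==ˢ sep) ∧ (y ==ˢ right) ≡ false
    disjoint sep = refl ; disjoint left = refl ; disjoint right = refl

  class-sum : class sep + class left + class right ≡ n
  class-sum = begin
    class sep + class left + class right                       ≡⟨ cong (_+ class right) (count-compatible left) ⟨
    count (λ w → not (across left (side w))) + class right     ≡⟨ count-∨ _ _ (λ w → disjoint (side w)) ⟨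
    count (λ w → not (across left (side w)) ∨ (side w ==ˢ right)) ≡⟨ count-cong (λ w → total (side w)) ⟩
    count {n} (λ _ → true)                                     ≡⟨ count-⊤ n ⟩
    n                                                          ∎
    where
    open ≡-Reasoning
    disjoint : ∀ y → not (across left y) ∧ (y ==ˢ right) ≡ false
    disjoint sep = refl ; disjoint left = refl ; disjoint right = refl
    total : ∀ y → not (across left y) ∨ (y ==ˢ right) ≡ true
    total sep = refl ; total left = refl ; total right = refl

  closedNbhd⊆compatible : ∀ z → closedNbhd G z ⊆ᵇ (λ w → not (across (side z) (side w)))
  closedNbhd⊆compatible z w zw with adj G z w in adj-zw | across (side z) (side w) in zw-across
  ... | true  | true  = contradiction (trans (sym adj-zw) (across⇒¬adj z w zw-across)) λ ()
  ... | _     | false = refl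
  ... | false | true  rewrite ==⇒≡ w z zw = contradiction (trans (sym zw-across) (across-irrefl (side z))) λ ()

  degree-bound : ∀ z → suc (degree G z) ≤ compatibleCount (side z)
  degree-bound z = begin
    suc (degree G z)                           ≡⟨ count-closedNbhd G z ⟨
    count (closedNbhd G z)                     ≤⟨ count-mono (closedNbhd⊆compatible z) ⟩
    count (λ w → not (across (side z) (side w))) ≡⟨ count-compatible (side z) ⟩
    compatibleCount (side z)                   ∎
    where open ≤-Reasoning

  adj⇒¬across : ∀ {p q} → adj G p q ≡ true → across (side p) (side q) ≡ false
  adj⇒¬across {p} {q} pq with across (side p) (side q) in pq-across
  ... | false = refl
  ... | true  = contradiction (trans (sym pq) (across⇒¬adj p q pq-across)) λ ()

  allowed : Fin n → Fin n → Bool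
  allowed p q = not (p == q) ∧ not (across (side p) (side q))

  adj⇒allowed : ∀ p q → adj G p q ≡ true → allowed p q ≡ true
  adj⇒allowed p q pq = cong₂ (λ a b → not a ∧ not b) (trans (==-sym p q) (adj⇒≢ G pq)) (adj⇒¬across pq)

  private
    adj∨across : Fin n → Fin n → Bool
    adj∨across p q = adj G p q ∨ across (side p) (side q)

  count²-across : count² (λ p q → across (side p) (side q)) ≡ 2 * (class left * class right)
  count²-across = begin
    count² (λ p q → across (side p) (side q))            ≡⟨ count²-cong (λ p q → split (side p) (side q)) ⟩
    count² (λ p q → L×R p q ∨ R×L p q)                   ≡⟨ count²-∨ L×R R×L (λ p q → disjoint (side p) (side q)) ⟩
    count² L×R + count² R×L                              ≡⟨ cong₂ _+_ (count²-∧ (_==ˢ left ∘ side) (_==ˢ right ∘ side))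
                                                                      (count²-∧ (_==ˢ right ∘ side) (_==ˢ left ∘ side)) ⟩
    class left * class right + class right * class left ≡⟨ cong (class left * class right +_)
                                                              (trans (*-comm (class right) (class left)) (sym (+-identityʳ _))) ⟩
    2 * (class left * class right)                       ∎
    where
    open ≡-Reasoning
    L×R R×L : Fin n → Fin n → Bool
    L×R p q = (side p ==ˢ left) ∧ (side q ==ˢ right)
    R×L p q = (side p ==ˢ right) ∧ (side q ==ˢ left)
    split : ∀ x y → across x y ≡ ((x ==ˢ left) ∧ (y ==ˢ right)) ∨ ((x ==ˢ right) ∧ (y ==ˢ left))
    split sep   _     = refl
    split left  sep   = refl
    split left  left  = refl
    split left  right = refl
    split right sep   = refl
    split right left  = refl
    split right right = refl
    disjoint : ∀ x y → ((x ==ˢ left) ∧ (y ==ˢ right)) ∧ ((x ==ˢ right) ∧ (y ==ˢ left)) ≡ false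
    disjoint sep   _     = refl
    disjoint left  sep   = refl
    disjoint left  left  = refl
    disjoint left  right = refl
    disjoint right _     = refl

  count²-adj∨across : count² adj∨across ≡ 2 * (size G + class left * class right)
  count²-adj∨across = begin
    count² adj∨across                                          ≡⟨ count²-∨ (adj G) _ adj∩across ⟩
    count² (adj G) + count² (λ p q → across (side p) (side q)) ≡⟨ cong₂ _+_ count²-adj count²-across ⟩
    2 * size G + 2 * (class left * class right)                ≡⟨ *-distribˡ-+ 2 (size G) _ ⟨
    2 * (size G + class left * class right)                    ∎
    where
    open ≡-Reasoning
    adj∩across : ∀ p q → adj G p q ∧ across (side p) (side q) ≡ false
    adj∩across p q with adj G p q in pq
    ... | false = refl
    ... | true  = adj⇒¬across pq
    count²-adj : count² (adj G) ≡ 2 * size G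
    count²-adj = trans (count²-symmetric (adj G) (adj-sym G) (irrefl G)) (cong (2 *_) (sym (size≡count² G)))

  adj∨across⊆≢ : ∀ p → adj∨across p ⊆ᵇ (λ q → not (p == q))
  adj∨across⊆≢ p q e with adj G p q in pq
  ... | true  = cong not (trans (==-sym p q) (adj⇒≢ G pq))
  ... | false with p == q in p=q
  ...   | false = refl
  ...   | true  = contradiction (trans (sym (subst (λ r → across (side p) (side r) ≡ true) (sym (==⇒≡ p q p=q)) e))
                                       (across-irrefl (side p))) λ ()

  size-bound : size G + class left * class right ≤ n C 2
  size-bound = *-cancelˡ-≤ 2 (begin
    2 * (size G + class left * class right) ≡⟨ count²-adj∨across ⟨
    count² adj∨across                       ≤⟨ count²-mono {R′ = λ p q → not (p == q)} adj∨across⊆≢ ⟩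
    count² {n} {n} (λ p q → not (p == q))   ≡⟨ count²-≢ n ⟩
    2 * (n C 2)                             ∎)
    where open ≤-Reasoning

  size-bound-< : ∀ p q → allowed p q ≡ true → adj G p q ≡ false → size G + class left * class right < n C 2
  size-bound-< p q pq-allowed ¬pq = *-cancelˡ-< 2 _ _ (begin-strict
    2 * (size G + class left * class right) ≡⟨ count²-adj∨across ⟨
    count² adj∨across                       <⟨ count²-mono-< {R′ = λ p q → not (p == q)} adj∨across⊆≢ p q missing (∧-conicalˡ (not (p == q)) _ pq-allowed) ⟩
    count² {n} {n} (λ p q → not (p == q))   ≡⟨ count²-≢ n ⟩
    2 * (n C 2)                             ∎)
    where
    open ≤-Reasoning
    missing : adj∨across p q ≡ false
    missing = cong₂ _∨_ ¬pq (not-injective (∧-conicalʳ (not (p == q)) _ pq-allowed))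

  Saturated : Set
  Saturated = ∀ p q → allowed p q ≡ true → adj G p q ≡ true

  tight⇒saturated : n C 2 ≤ size G + class left * class right → Saturated
  tight⇒saturated tight p q pq-allowed with adj G p q in pq
  ... | true  = refl
  ... | false = contradiction tight (<⇒≱ (size-bound-< p q pq-allowed pq))

  saturated⇒adj≡allowed : Saturated → ∀ p q → adj G p q ≡ allowed p q
  saturated⇒adj≡allowed saturated p q with adj G p q in pq
  ... | true  = sym (adj⇒allowed p q pq)
  ... | false with allowed p q in pq-allowed
  ...   | false = refl
  ...   | true  = contradiction (trans (sym pq) (saturated p q pq-allowed)) λ ()

  saturated⇒degree : Saturated → ∀ z → suc (degree G z) ≡ compatibleCount (side z)
  saturated⇒degree saturated z = ≤-antisym (degree-bound z) (begin
    compatibleCount (side z)                     ≡⟨ count-compatible (side z) ⟨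
    count (λ w → not (across (side z) (side w))) ≤⟨ count-mono compatible⊆closedNbhd ⟩
    count (closedNbhd G z)                       ≡⟨ count-closedNbhd G z ⟩
    suc (degree G z)                             ∎)
    where
    open ≤-Reasoning
    compatible⊆closedNbhd : (λ w → not (across (side z) (side w))) ⊆ᵇ closedNbhd G z
    compatible⊆closedNbhd w zw with w == z in w=z
    ... | true  = ∨-zeroʳ (adj G z w)
    ... | false = trans (∨-identityʳ (adj G z w))
                        (saturated z w (cong₂ (λ a b → not a ∧ b) (trans (==-sym z w) w=z) zw))

-- Arithmetic of the edge count

C2-shift : ∀ n → 2 ≤ n → n C 2 + 3 ≡ (n ∸ 2) C 2 + 2 * n
C2-shift (suc zero) (s≤s ())
C2-shift (suc (suc k)) _ = begin
  suc (suc k) C 2 + 3              ≡⟨ cong (_+ 3) (nCk+nC[k+1]≡[n+1]C[k+1] (suc k) 1) ⟨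
  (suc k C 1 + suc k C 2) + 3      ≡⟨ cong (λ x → (suc k C 1 + x) + 3) (nCk+nC[k+1]≡[n+1]C[k+1] k 1) ⟨
  (suc k C 1 + (k C 1 + k C 2)) + 3 ≡⟨ cong₂ (λ x y → (x + (y + k C 2)) + 3) (nC1≡n (suc k)) (nC1≡n k) ⟩
  (suc k + (k + k C 2)) + 3        ≡⟨ solve-∀′ k (k C 2) ⟩
  k C 2 + 2 * suc (suc k)          ∎
  where
  open ≡-Reasoning
  solve-∀′ : ∀ k c → (suc k + (k + c)) + 3 ≡ c + 2 * suc (suc k)
  solve-∀′ = solve-∀

private
  +-≤-self⇒≡0 : ∀ m k → m + k ≤ m → k ≡ 0
  +-≤-self⇒≡0 m k h = n≤0⇒n≡0 (+-cancelˡ-≤ m k 0 (subst (m + k ≤_) (sym (+-identityʳ m)) h))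

  side-excess : ∀ s u a → suc s + u < s + a → ∃[ a′ ] u + 2 + a′ ≡ a
  side-excess s u a h = m≤n⇒∃[o]m+o≡n (+-cancelˡ-≤ s _ _ (subst (_≤ s + a) (shift s u) h))
    where
    shift : ∀ s u → suc (suc s + u) ≡ s + (u + 2)
    shift = solve-∀

-- With δ = s + 1 + u, a = u + 2 + a′, b = u + 2 + b′ and n = s + a + b, part (a)'s count leaves no room.
excess-a : ∀ s u a′ b′ e →
           2 * (suc s + u) + 2 + (u + 2 + a′) * (u + 2 + b′) + e ≤ 2 * (s + (u + 2 + a′) + (u + 2 + b′)) →
           u ≡ 0 × (a′ ≡ 0 ⊎ b′ ≡ 0) × e ≡ 0
excess-a s u a′ b′ e h with m+n≡0⇒m≡0 u K≡0 | m+n≡0⇒n≡0 u (m+n≡0⇒n≡0 u K≡0)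
  where
  K≡0 : u + (u + (e + (u + a′) * (u + b′))) ≡ 0
  K≡0 = +-≤-self⇒≡0 (2 * (s + (u + 2 + a′) + (u + 2 + b′))) _
          (subst (_≤ 2 * (s + (u + 2 + a′) + (u + 2 + b′))) (excess≡ s u a′ b′ e) h)
    where
    excess≡ : ∀ s u a′ b′ e → 2 * (suc s + u) + 2 + (u + 2 + a′) * (u + 2 + b′) + e ≡
                               2 * (s + (u + 2 + a′) + (u + 2 + b′)) + (u + (u + (e + (u + a′) * (u + b′))))
    excess≡ = solve-∀
... | refl | rest with m*n≡0⇒m≡0∨n≡0 a′ (m+n≡0⇒n≡0 e rest)
...   | a′≡0∨b′≡0 = refl , a′≡0∨b′≡0 , m+n≡0⇒m≡0 e rest

excess-b : ∀ s u a′ b′ e →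
           suc s + u + 3 + (u + 2 + a′) * (u + 2 + b′) + e ≤ 2 * (s + (u + 2 + a′) + (u + 2 + b′)) →
           2 * (suc s + u) + 3 ≤ s + (u + 2 + a′) + (u + 2 + b′) →
           u ≡ 0 × (a′ ≡ 0 ⊎ b′ ≡ 0 ⊎ e ≡ 0)
excess-b s u a′ b′ e h₁ h₂ = small-product u a′ b′ (≤-trans (+-monoˡ-≤ 1 product≤s) s<a′+b′)
  where
  product≤s : (u + a′) * (u + b′) + u + e ≤ s
  product≤s = +-cancelʳ-≤ (s + 4 * u + 2 * a′ + 2 * b′ + 8) _ _
    (subst₂ _≤_ (lhs s u a′ b′ e) (rhs s u a′ b′) h₁)
    where
    lhs : ∀ s u a′ b′ e → suc s + u + 3 + (u + 2 + a′) * (u + 2 + b′) + e ≡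
                          ((u + a′) * (u + b′) + u + e) + (s + 4 * u + 2 * a′ + 2 * b′ + 8)
    lhs = solve-∀
    rhs : ∀ s u a′ b′ → 2 * (s + (u + 2 + a′) + (u + 2 + b′)) ≡ s + (s + 4 * u + 2 * a′ + 2 * b′ + 8)
    rhs = solve-∀
  s<a′+b′ : s + 1 ≤ a′ + b′
  s<a′+b′ = +-cancelʳ-≤ (s + 2 * u + 4) _ _ (subst₂ _≤_ (lhs s u) (rhs s u a′ b′) h₂)
    where
    lhs : ∀ s u → 2 * (suc s + u) + 3 ≡ (s + 1) + (s + 2 * u + 4)
    lhs = solve-∀
    rhs : ∀ s u a′ b′ → s + (u + 2 + a′) + (u + 2 + b′) ≡ (a′ + b′) + (s + 2 * u + 4)
    rhs = solve-∀
  small-product : ∀ u a′ b′ → (u + a′) * (u + b′) + u + e + 1 ≤ a′ + b′ → u ≡ 0 × (a′ ≡ 0 ⊎ b′ ≡ 0 ⊎ e ≡ 0)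
  small-product (suc u) a′ b′ h = contradiction (subst (_≤ a′ + b′) (too-big u a′ b′ e) h) (m+1+n≰m (a′ + b′))
    where
    too-big : ∀ u a′ b′ e → (suc u + a′) * (suc u + b′) + suc u + e + 1 ≡
                            (a′ + b′) + suc (u * u + 2 * u + u * b′ + a′ * u + a′ * b′ + suc u + e + 1)
    too-big = solve-∀
  small-product zero zero    b′       h = refl , inj₁ refl
  small-product zero (suc x) zero     h = refl , inj₂ (inj₁ refl)
  small-product zero (suc x) (suc y) h =
    refl , inj₂ (inj₂ (m+n≡0⇒n≡0 (x * y) (+-≤-self⇒≡0 (suc x + suc y) (x * y + e) (subst (_≤ suc x + suc y) (product x y e) h))))
    where
    product : ∀ x y e → suc x * suc y + 0 + e + 1 ≡ (suc x + suc y) + (x * y + e)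
    product = solve-∀

private
  budget-a : ∀ D N δ {C m x e} → D + 2 * δ ∸ 1 ≤ m → m + x + e ≡ C → C + 3 ≡ D + 2 * N →
             2 * δ + 2 + x + e ≤ 2 * N
  budget-a D N δ {C} {m} {x} {e} m≥ m+x+e≡C C≡ = +-cancelˡ-≤ D _ _ (begin
    D + (2 * δ + 2 + x + e)             ≡⟨ regroup D δ x e ⟩
    (D + 2 * δ) + (x + e + 2)           ≤⟨ +-monoˡ-≤ (x + e + 2) (m≤n+m∸n (D + 2 * δ) 1) ⟩
    (1 + (D + 2 * δ ∸ 1)) + (x + e + 2) ≤⟨ +-monoˡ-≤ (x + e + 2) (+-monoʳ-≤ 1 m≥) ⟩
    (1 + m) + (x + e + 2)             ≡⟨ solve₃ m x e ⟩
    (m + x + e) + 3                   ≡⟨ cong (_+ 3) m+x+e≡C ⟩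
    C + 3                             ≡⟨ C≡ ⟩
    D + 2 * N                         ∎)
    where
    open ≤-Reasoning
    solve₃ : ∀ m x e → (1 + m) + (x + e + 2) ≡ (m + x + e) + 3
    solve₃ = solve-∀
    regroup : ∀ D δ x e → D + (2 * δ + 2 + x + e) ≡ (D + 2 * δ) + (x + e + 2)
    regroup = solve-∀

  budget-b : ∀ D N δ {C m x e} → D + δ ≤ m → m + x + e ≡ C → C + 3 ≡ D + 2 * N →
             δ + 3 + x + e ≤ 2 * N
  budget-b D N δ {C} {m} {x} {e} m≥ m+x+e≡C C≡ = +-cancelˡ-≤ D _ _ (begin
    D + (δ + 3 + x + e)   ≡⟨ regroup D δ x e ⟩
    (D + δ) + (x + e + 3) ≤⟨ +-monoˡ-≤ (x + e + 3) m≥ ⟩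
    m + (x + e + 3)       ≡⟨ solve₃ m x e ⟩
    (m + x + e) + 3       ≡⟨ cong (_+ 3) m+x+e≡C ⟩
    C + 3                 ≡⟨ C≡ ⟩
    D + 2 * N             ∎)
    where
    open ≤-Reasoning
    regroup : ∀ D δ x e → D + (δ + 3 + x + e) ≡ (D + δ) + (x + e + 3)
    regroup = solve-∀
    solve₃ : ∀ m x e → m + (x + e + 3) ≡ (m + x + e) + 3
    solve₃ = solve-∀

dense-a : ∀ {n s a b δ m} → 2 ≤ n → s + a + b ≡ n → s < δ → δ < s + a → δ < s + b →
          (n ∸ 2) C 2 + 2 * δ ∸ 1 ≤ m → m + a * b ≤ n C 2 →
          δ ≡ suc s × (a ≡ 2 ⊎ b ≡ 2) × n C 2 ≤ m + a * b
dense-a {s = s} 2≤n refl s<δ δ<s+a δ<s+b m≥ m+ab≤C with m≤n⇒∃[o]m+o≡n s<δ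
... | u , refl with side-excess s u _ δ<s+a | side-excess s u _ δ<s+b | m≤n⇒∃[o]m+o≡n m+ab≤C
... | a′ , refl | b′ , refl | e , m+ab+e≡C
    with excess-a s u a′ b′ e (budget-a ((N ∸ 2) C 2) N (suc s + u) m≥ m+ab+e≡C (C2-shift N 2≤n))
  where N = s + (u + 2 + a′) + (u + 2 + b′)
... | refl , a′≡0⊎b′≡0 , refl = +-identityʳ (suc s) , two a′≡0⊎b′≡0 , ≤-reflexive (trans (sym m+ab+e≡C) (+-identityʳ _))
  where
  two : a′ ≡ 0 ⊎ b′ ≡ 0 → 2 + a′ ≡ 2 ⊎ 2 + b′ ≡ 2
  two (inj₁ refl) = inj₁ refl
  two (inj₂ refl) = inj₂ refl

dense-b : ∀ {n s a b δ m} → 2 ≤ n → s + a + b ≡ n → s < δ → δ < s + a → δ < s + b →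
          2 * δ + 3 ≤ n → (n ∸ 2) C 2 + δ ≤ m → m + a * b ≤ n C 2 →
          δ ≡ suc s × ((a ≡ 2 ⊎ b ≡ 2) ⊎ n C 2 ≤ m + a * b)
dense-b {s = s} 2≤n refl s<δ δ<s+a δ<s+b n≥ m≥ m+ab≤C with m≤n⇒∃[o]m+o≡n s<δ
... | u , refl with side-excess s u _ δ<s+a | side-excess s u _ δ<s+b | m≤n⇒∃[o]m+o≡n m+ab≤C
... | a′ , refl | b′ , refl | e , m+ab+e≡C
    with excess-b s u a′ b′ e (budget-b ((N ∸ 2) C 2) N (suc s + u) m≥ m+ab+e≡C (C2-shift N 2≤n)) n≥
  where N = s + (u + 2 + a′) + (u + 2 + b′)
... | refl , inj₁ refl          = +-identityʳ (suc s) , inj₁ (inj₁ refl)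
... | refl , inj₂ (inj₁ refl)   = +-identityʳ (suc s) , inj₁ (inj₂ refl)
... | refl , inj₂ (inj₂ refl)   = +-identityʳ (suc s) , inj₂ (≤-reflexive (trans (sym m+ab+e≡C) (+-identityʳ _)))

-- Embedding into K_{s} ∨ (K₂ ∪ K_{n−s−2}) by sorting the vertices by side

level : Side → ℕ
level sep   = 0
level left  = 1
level right = 2

blockAdj : ℕ → ℕ → Bool
blockAdj x y = (x ≡ᵇ 0) ∨ (y ≡ᵇ 0) ∨ (x ≡ᵇ y)

blockAdj-level : ∀ x y → blockAdj (level x) (level y) ≡ not (across x y)
blockAdj-level sep   _     = refl
blockAdj-level left  sep   = refl
blockAdj-level left  left  = refl
blockAdj-level left  right = refl
blockAdj-level right sep   = refl
blockAdj-level right left  = refl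
blockAdj-level right right = refl

<⇒<ᵇ≡true : ∀ {x y} → x < y → (x <ᵇ y) ≡ true
<⇒<ᵇ≡true x<y = Equivalence.to T-≡ (<⇒<ᵇ x<y)

<ᵇ≡true⇒< : ∀ {x y} → (x <ᵇ y) ≡ true → x < y
<ᵇ≡true⇒< {x} {y} e = <ᵇ⇒< x y (Equivalence.from T-≡ e)

≤⇒<ᵇ≡false : ∀ {x y} → y ≤ x → (x <ᵇ y) ≡ false
≤⇒<ᵇ≡false {x} {y} y≤x with x <ᵇ y in e
... | false = refl
... | true  = contradiction y≤x (<⇒≱ (<ᵇ≡true⇒< e))

block-sep : ∀ d x → x < d ∸ 1 → block d x ≡ 0
block-sep d x x<d-1 rewrite <⇒<ᵇ≡true x<d-1 = refl

block-left : ∀ d x → d ∸ 1 ≤ x → x < d + 1 → block d x ≡ 1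
block-left d x d-1≤x x<d+1 rewrite ≤⇒<ᵇ≡false d-1≤x | <⇒<ᵇ≡true x<d+1 = refl

block-right : ∀ d x → d + 1 ≤ x → block d x ≡ 2
block-right d x d+1≤x rewrite ≤⇒<ᵇ≡false (≤-trans (m∸n≤m d 1) (≤-trans (m≤m+n d 1) d+1≤x))
                            | ≤⇒<ᵇ≡false d+1≤x = refl

≡ᵇ-injective : (g : Fin n → ℕ) → (∀ {p q} → g p ≡ g q → p ≡ q) → ∀ p q → (g p ≡ᵇ g q) ≡ (p == q)
≡ᵇ-injective g g-inj p q with p == q in p=q
... | true  rewrite ==⇒≡ p q p=q = ≡ᵇ-refl (g q)
... | false with g p ≡ᵇ g q in gp=gq
...   | false = refl
...   | true  with g-inj (≡ᵇ⇒≡′ (g p) (g q) gp=gq)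
...     | refl = contradiction (trans (sym p=q) (==-refl p)) λ ()

module Sorting (role : Fin n → Side) where

  -- Vertices ordered by level, then by index; the rank of a vertex is its position in this order.
  key : Fin n → ℕ
  key w = level (role w) * n + toℕ w

  rank : Fin n → ℕ
  rank w = count (λ w′ → key w′ <ᵇ key w)

  key-level-< : ∀ p q → level (role p) < level (role q) → key p < key q
  key-level-< p q lt = begin-strict
    level (role p) * n + toℕ p     <⟨ +-monoʳ-< (level (role p) * n) (toℕ<n p) ⟩
    level (role p) * n + n         ≡⟨ +-comm (level (role p) * n) n ⟩
    suc (level (role p)) * n       ≤⟨ *-monoˡ-≤ n lt ⟩
    level (role q) * n             ≤⟨ m≤m+n (level (role q) * n) (toℕ q) ⟩
    key q                          ∎
    where open ≤-Reasoning

  key-<⇒level-≤ : ∀ p q → key p < key q → level (role p) ≤ level (role q)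
  key-<⇒level-≤ p q kp<kq with level (role p) ≤? level (role q)
  ... | yes ≤ = ≤
  ... | no  ≰ = contradiction kp<kq (<-asym (key-level-< q p (≰⇒> ≰)))

  key-injective : ∀ {p q} → key p ≡ key q → p ≡ q
  key-injective {p} {q} kp≡kq with <-cmp (level (role p)) (level (role q))
  ... | tri< lt _ _ = contradiction kp≡kq (<⇒≢ (key-level-< p q lt))
  ... | tri> _ _ gt = contradiction (sym kp≡kq) (<⇒≢ (key-level-< q p gt))
  ... | tri≈ _ eq _ = toℕ-injective (+-cancelˡ-≡ (level (role p) * n) _ _
                        (trans kp≡kq (cong (λ l → l * n + toℕ q) (sym eq))))

  rank-< : ∀ p q → key p < key q → rank p < rank q
  rank-< p q kp<kq = count-mono-< (λ w e → <⇒<ᵇ≡true (<-trans (<ᵇ≡true⇒< e) kp<kq)) p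
                                  (<ᵇ-irrefl (key p)) (<⇒<ᵇ≡true kp<kq)

  rank-injective : ∀ {p q} → rank p ≡ rank q → p ≡ q
  rank-injective {p} {q} rp≡rq with <-cmp (key p) (key q)
  ... | tri< lt _ _ = contradiction rp≡rq (<⇒≢ (rank-< p q lt))
  ... | tri> _ _ gt = contradiction (sym rp≡rq) (<⇒≢ (rank-< q p gt))
  ... | tri≈ _ eq _ = key-injective eq

  rank<n : ∀ w → rank w < n
  rank<n w = ≤-trans (count-mono-< {Q = λ _ → true} (λ _ _ → refl) w (<ᵇ-irrefl (key w)) refl)
                     (≤-reflexive (count-⊤ n))

  below : ℕ → ℕ
  below c = count (λ w → level (role w) <ᵇ c)

  rank<below : ∀ w c → level (role w) < c → rank w < below c
  rank<below w c lw<c = count-mono-<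
    (λ w′ e → <⇒<ᵇ≡true (≤-<-trans (key-<⇒level-≤ w′ w (<ᵇ≡true⇒< e)) lw<c)) w
    (<ᵇ-irrefl (key w)) (<⇒<ᵇ≡true lw<c)

  below≤rank : ∀ w c → c ≤ level (role w) → below c ≤ rank w
  below≤rank w c c≤lw = count-mono (λ w′ e → <⇒<ᵇ≡true (key-level-< w′ w (<-≤-trans (<ᵇ≡true⇒< e) c≤lw)))

  module Sorted {s : ℕ} (∣sep∣ : count (λ w → role w ==ˢ sep) ≡ s) (∣left∣ : count (λ w → role w ==ˢ left) ≡ 2) where

    below-1 : below 1 ≡ s
    below-1 = trans (count-cong (λ w → pointwise (role w))) ∣sep∣
      where
      pointwise : ∀ x → (level x <ᵇ 1) ≡ (x ==ˢ sep)
      pointwise sep = refl ; pointwise left = refl ; pointwise right = refl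

    below-2 : below 2 ≡ suc s + 1
    below-2 = begin
      below 2                                                          ≡⟨ count-cong (λ w → pointwise (role w)) ⟩
      count (λ w → (role w ==ˢ sep) ∨ (role w ==ˢ left))               ≡⟨ count-∨ _ _ (λ w → disjoint (role w)) ⟩
      count (λ w → role w ==ˢ sep) + count (λ w → role w ==ˢ left)      ≡⟨ cong₂ _+_ ∣sep∣ ∣left∣ ⟩
      s + 2                                                            ≡⟨ +-suc s 1 ⟩
      suc s + 1                                                        ∎
      where
      open ≡-Reasoning
      pointwise : ∀ x → (level x <ᵇ 2) ≡ (x ==ˢ sep) ∨ (x ==ˢ left)
      pointwise sep = refl ; pointwise left = refl ; pointwise right = refl
      disjoint : ∀ x → (x ==ˢ sep) ∧ (x ==ˢ left) ≡ false
      disjoint sep = refl ; disjoint left = refl ; disjoint right = refl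

    block-rank : ∀ w → block (suc s) (rank w) ≡ level (role w)
    block-rank w = by-side (role w) refl
      where
      by-side : ∀ x → role w ≡ x → block (suc s) (rank w) ≡ level x
      by-side sep   rw = block-sep (suc s) (rank w)
        (subst (rank w <_) below-1 (rank<below w 1 (≤-reflexive (cong (suc ∘ level) rw))))
      by-side left  rw = block-left (suc s) (rank w)
        (subst (_≤ rank w) below-1 (below≤rank w 1 (≤-reflexive (cong level (sym rw)))))
        (subst (rank w <_) below-2 (rank<below w 2 (≤-reflexive (cong (suc ∘ level) rw))))
      by-side right rw = block-right (suc s) (rank w)
        (subst (_≤ rank w) below-2 (below≤rank w 2 (≤-reflexive (cong level (sym rw)))))

    sorted : Fin n → Fin n
    sorted w = fromℕ< (rank<n w)

    toℕ-sorted : ∀ w → toℕ (sorted w) ≡ rank w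
    toℕ-sorted w = toℕ-fromℕ< (rank<n w)

    sorted-injective : ∀ p q → sorted p ≡ sorted q → p ≡ q
    sorted-injective p q e = rank-injective (trans (sym (toℕ-sorted p)) (trans (cong toℕ e) (toℕ-sorted q)))

    specialAdj-sorted : ∀ p q → specialAdj n (suc s) (sorted p) (sorted q) ≡ not (p == q) ∧ not (across (role p) (role q))
    specialAdj-sorted p q = begin
      specialAdj n (suc s) (sorted p) (sorted q)
        ≡⟨ cong₂ (λ x y → not (x ≡ᵇ y) ∧ blockAdj (block (suc s) x) (block (suc s) y)) (toℕ-sorted p) (toℕ-sorted q) ⟩
      not (rank p ≡ᵇ rank q) ∧ blockAdj (block (suc s) (rank p)) (block (suc s) (rank q))
        ≡⟨ cong₂ (λ b c → not b ∧ c) (≡ᵇ-injective rank rank-injective p q)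
                 (trans (cong₂ blockAdj (block-rank p) (block-rank q)) (blockAdj-level (role p) (role q))) ⟩
      not (p == q) ∧ not (across (role p) (role q))
        ∎
      where open ≡-Reasoning

swap : Side → Side
swap sep   = sep
swap left  = right
swap right = left

across-swap : ∀ x y → across (swap x) (swap y) ≡ across x y
across-swap sep   _     = refl
across-swap left  sep   = refl
across-swap left  left  = refl
across-swap left  right = refl
across-swap right sep   = refl
across-swap right left  = refl
across-swap right right = refl

-- S goes to the block K_{s}, the two-vertex side to K₂ and the other side to the last block.
sides-embedding : {G : Graph n} (σ : Separation G) {s : ℕ} → Separation.class σ sep ≡ s →
                  Separation.class σ left ≡ 2 ⊎ Separation.class σ right ≡ 2 →
                  Σ[ f ∈ (Fin n → Fin n) ] (∀ p q → f p ≡ f q → p ≡ q) ×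
                    (∀ p q → specialAdj n (suc s) (f p) (f q) ≡ allowed σ p q)
sides-embedding σ ∣sep∣ (inj₁ ∣left∣) = sorted , sorted-injective , specialAdj-sorted
  where open Sorting.Sorted (Separation.side σ) ∣sep∣ ∣left∣
sides-embedding {n} σ ∣sep∣ (inj₂ ∣right∣) = sorted , sorted-injective , λ p q →
  trans (specialAdj-sorted p q) (cong (λ b → not (p == q) ∧ not b) (across-swap (side p) (side q)))
  where
  open Separation σ
  sep-swap : ∀ x → (swap x ==ˢ sep) ≡ (x ==ˢ sep)
  sep-swap sep = refl ; sep-swap left = refl ; sep-swap right = refl
  left-swap : ∀ x → (swap x ==ˢ left) ≡ (x ==ˢ right)
  left-swap sep = refl ; left-swap left = refl ; left-swap right = refl
  open Sorting.Sorted (swap ∘ side) (trans (count-cong (sep-swap ∘ side)) ∣sep∣)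
                                    (trans (count-cong (left-swap ∘ side)) ∣right∣)

injective⇒surjective : (f : Fin n → Fin n) → (∀ p q → f p ≡ f q → p ≡ q) → ∀ y → ∃[ x ] f x ≡ y
injective⇒surjective {suc n} f f-inj y with any? (λ x → f x Fin.≟ y)
... | yes found = found
... | no ¬found = contradiction (injective⇒≤ punched-injective) 1+n≰n
  where
  punched : Fin (suc n) → Fin n
  punched x = punchOut {i = y} {j = f x} (λ y≡fx → ¬found (x , sym y≡fx))
  punched-injective : ∀ {p q} → punched p ≡ punched q → p ≡ q
  punched-injective {p} {q} e = f-inj p q (punchOut-injective (λ y≡fp → ¬found (p , sym y≡fp))
                                                               (λ y≡fq → ¬found (q , sym y≡fq)) e)

injective⇒↔ : (f : Fin n → Fin n) → (∀ p q → f p ≡ f q → p ≡ q) → Fin n ↔ Fin n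
injective⇒↔ f f-inj = mk↔ₛ′ f (proj₁ ∘ surjective) (proj₂ ∘ surjective) (λ x → f-inj _ x (proj₂ (surjective (f x))))
  where surjective = injective⇒surjective f f-inj

-- Separators smaller than the minimum degree

module _ {G : Graph n} (σ : Separation G) {δ : ℕ} (δ≤deg : ∀ v → δ ≤ degree G v)
         (sep<δ : Separation.class σ sep < δ) where
  open Separation σ

  δ<sep+left : δ < class sep + class left
  δ<sep+left = ≤-trans (s≤s (δ≤deg inner))
                       (subst (λ x → suc (degree G inner) ≤ compatibleCount σ x) side-inner (degree-bound σ inner))

  δ<sep+right : δ < class sep + class right
  δ<sep+right = ≤-trans (s≤s (δ≤deg outer))
                        (subst (λ x → suc (degree G outer) ≤ compatibleCount σ x) side-outer (degree-bound σ outer))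

  dense⇒iso : 2 ≤ n → (n ∸ 2) C 2 + 2 * δ ∸ 1 ≤ size G → IsoSpecial G δ
  dense⇒iso 2≤n m≥ with dense-a 2≤n (class-sum σ) sep<δ δ<sep+left δ<sep+right m≥ (size-bound σ)
  ... | δ≡ , two-side , tight = subst (IsoSpecial G) (sym δ≡) (injective⇒↔ f f-inj , adj≡special)
    where
    f = proj₁ (sides-embedding σ refl two-side)
    f-inj = proj₁ (proj₂ (sides-embedding σ refl two-side))
    adj≡special : ∀ p q → adj G p q ≡ specialAdj n (suc (class sep)) (f p) (f q)
    adj≡special p q = trans (saturated⇒adj≡allowed σ (tight⇒saturated σ tight) p q)
                            (sym (proj₂ (proj₂ (sides-embedding σ refl two-side)) p q))

  -- In a saturated separation a vertex of S has degree n − 1 and one on a side of size c has degree s + c − 1.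
  saturated⇒two-side : Saturated σ → 2 * δ + 3 ≤ n → δ ≡ suc (class sep) → ∀ v₀ → degree G v₀ ≡ δ →
                       class left ≡ 2 ⊎ class right ≡ 2
  saturated⇒two-side saturated n≥ δ≡ v₀ deg-v₀ = by-side (side v₀) (trans (sym deg≡) (saturated⇒degree σ saturated v₀))
    where
    deg≡ : suc (degree G v₀) ≡ class sep + 2
    deg≡ = trans (cong suc (trans deg-v₀ δ≡)) (sym (+-comm (class sep) 2))
    by-side : ∀ x → class sep + 2 ≡ compatibleCount σ x → class left ≡ 2 ⊎ class right ≡ 2
    by-side sep   e = contradiction (subst₂ _≤_ (spread δ) n≡1+δ n≥) (m+1+n≰m (suc δ))
      where
      n≡1+δ : n ≡ suc δ
      n≡1+δ = trans (sym e) (trans (+-comm (class sep) 2) (cong suc (sym δ≡)))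
      spread : ∀ δ → 2 * δ + 3 ≡ suc δ + suc (δ + 1)
      spread = solve-∀
    by-side left  e = inj₁ (sym (+-cancelˡ-≡ (class sep) _ _ e))
    by-side right e = inj₂ (sym (+-cancelˡ-≡ (class sep) _ _ e))

  two-side⇒subgraph : δ ≡ suc (class sep) → class left ≡ 2 ⊎ class right ≡ 2 → SubgraphSpecial G δ
  two-side⇒subgraph δ≡ two-side with sides-embedding σ refl two-side
  ... | f , f-inj , f-adj = subst (SubgraphSpecial G) (sym δ≡)
                                  (f , f-inj , λ p q pq → trans (f-adj p q) (adj⇒allowed σ p q pq))

  dense⇒subgraph : 2 ≤ n → 2 * δ + 3 ≤ n → (n ∸ 2) C 2 + δ ≤ size G → ∀ v₀ → degree G v₀ ≡ δ → SubgraphSpecial G δ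
  dense⇒subgraph 2≤n n≥ m≥ v₀ deg-v₀ with dense-b 2≤n (class-sum σ) sep<δ δ<sep+left δ<sep+right n≥ m≥ (size-bound σ)
  ... | δ≡ , inj₁ two-side = two-side⇒subgraph δ≡ two-side
  ... | δ≡ , inj₂ tight    = two-side⇒subgraph δ≡ (saturated⇒two-side (tight⇒saturated σ tight) n≥ δ≡ v₀ deg-v₀)

neighbourhood-separator : (G : Graph n) (v : Fin n) → suc (degree G v) < n →
                          ¬ Complete G × Σ[ S ∈ Subset n ] Separates G S × ∣ S ∣ ≡ degree G v
neighbourhood-separator G v 1+deg<n with nonNeighbour G v 1+deg<n
... | w , vw∉ = incomplete , neighbourhood G v , neighbourhood-separates G v w vw∉ , ∣neighbourhood∣ G v
  where
  incomplete : ¬ Complete G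
  incomplete complete = contradiction (trans (sym (complete v w v≢w)) (∨-conicalˡ (adj G v w) (w == v) vw∉)) λ ()
    where
    v≢w : v ≢ w
    v≢w refl = contradiction (trans (sym (==-refl v)) (∨-conicalʳ (adj G v v) (v == v) vw∉)) λ ()

theorem3p1 : ∀ (n : ℕ) (G : Graph n) (δ κ : ℕ) →
    5 ≤ n → Connected G → IsMinDegree G δ → 2 ≤ δ → IsConnectivity G κ →
    ((((n ∸ 2) C 2) + 2 * δ ∸ 1 ≤ size G → κ ≡ δ ⊎ IsoSpecial G δ)
    × (2 * δ + 3 ≤ n → ((n ∸ 2) C 2) + δ ≤ size G → κ ≡ δ ⊎ SubgraphSpecial G δ))
theorem3p1 n G δ κ 5≤n _ (δ≤deg , v₀ , deg-v₀) _ (κ-complete , κ-incomplete) with n ≤? suc δ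
... | yes n≤1+δ = (λ _ → inj₁ κ≡δ) , (λ _ _ → inj₁ κ≡δ)
  where
  κ≡δ : κ ≡ δ
  κ≡δ = trans (κ-complete (complete-if-degrees G (λ v → ≤-trans n≤1+δ (s≤s (δ≤deg v)))))
              (cong (_∸ 1) (≤-antisym n≤1+δ (subst (λ d → suc d ≤ n) deg-v₀ (degree<n G v₀))))
... | no n≰1+δ with neighbourhood-separator G v₀ (subst (λ d → suc d < n) (sym deg-v₀) (≰⇒> n≰1+δ))
...   | incomplete , N , N-separates , ∣N∣≡deg
      with m≤n⇒m<n∨m≡n (subst (κ ≤_) (trans ∣N∣≡deg deg-v₀) (proj₂ (κ-incomplete incomplete) N N-separates))
...     | inj₂ κ≡δ = (λ _ → inj₁ κ≡δ) , (λ _ _ → inj₁ κ≡δ)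
...     | inj₁ κ<δ with proj₁ (κ-incomplete incomplete)
...       | S , S-separates , ∣S∣≡κ with separation G S S-separates
...         | σ , ∣sep∣≡∣S∣ = (λ m≥ → inj₂ (dense⇒iso σ δ≤deg sep<δ 2≤n m≥))
                            , (λ n≥ m≥ → inj₂ (dense⇒subgraph σ δ≤deg sep<δ 2≤n n≥ m≥ v₀ deg-v₀))
  where
  2≤n = ≤-trans (s≤s (s≤s z≤n)) 5≤n
  sep<δ = subst (_< δ) (sym (trans ∣sep∣≡∣S∣ ∣S∣≡κ)) κ<δ
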